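{- Let $(e_i \mid i\in\omega)$ be a sequence of events with $e_i<_0 e_j \iff i<j$, with predicates $\mathrm{Add},\mathrm{Rem},\mathrm{Cnt}$ and functions $\mathrm{val},\chi$ as in the context, and let $\gamma$ be a function satisfying FS0, FS1 and FS2. Then for every event $x$ with $\mathrm{Op}^1(x)$ there is no event $y$ with $\mathrm{Op}^0(y)$ such that $\gamma(x)<_0 y<_0 x$ and $\mathrm{val}(x)=\mathrm{val}(y)$.
   Context: Setting (serial set object). We are given an infinite sequence of events $(e_i\mid i\in\omega)$, linearly ordered by $<_0$ where $e_i<_0 e_j$ iff $i<j$. Three unary predicates $\mathrm{Add},\mathrm{Rem},\mathrm{Cnt}$ partition the events. Each event $a$ has a key $\mathrm{val}(a)\in\mathbb N$ and a status $\chi(a)\in\{0,1,f\}$, where $\chi(a)\in\{0,1\}$ whenever $\mathrm{Cnt}(a)$. Shorthands: for $p\in\{0,1,f\}$, $\mathrm{Add}^p(a)$ means $\mathrm{Add}(a)\wedge\chi(a)=p$ and $\mathrm{Rem}^p(a)$ means $\mathrm{Rem}(a)\wedge\chi(a)=p$; for $p\in\{0,1\}$, $\mathrm{Cnt}^p(a)$ means $\mathrm{Cnt}(a)\wedge \chi(a)=p$ and $\mathrm{Op}^p(a)$ means $(\mathrm{Add}(a)\vee\mathrm{Rem}(a)\vee\mathrm{Cnt}(a))\wedge\chi(a)=p$. The properties of a function $\gamma$: FS0: $<_0$ is a linear ordering of the events; $\mathrm{Add},\mathrm{Rem},\mathrm{Cnt}$ are pairwise disjoint; $\gamma$ is defined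 on the set of $\mathrm{Op}^1$ events and its values are $\mathrm{Add}^0$ events. FS1: for every event $a$ with $\mathrm{Op}^1(a)$: $\gamma(a)<_0 a$, $\mathrm{Add}^0(\gamma(a))$, $\mathrm{val}(a)=\mathrm{val}(\gamma(a))$, and there is no event $r$ with $\mathrm{Rem}^1(r)$, $\gamma(r)=\gamma(a)$ and $\gamma(a)<_0 r<_0 a$. FS2: for all events $a<_0 b$ with $\mathrm{Add}^0(a)$, $\mathrm{Op}^0(b)$ and $\mathrm{val}(a)=\mathrm{val}(b)$, there is an event $r$ with $a<_0 r<_0 b$, $\mathrm{Rem}^1(r)$ and $a=\gamma(r)$. -}

module Defs where

open import Data.Nat using (ℕ; _<_)
open import Data.Product using (_×_; ∃-syntax; Σ)
import Data.Product
open import Relation.Binary.PropositionalEquality using (_≡_; _≢_)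
open import Relation.Nullary using (¬_)

-- Events are e_i, identified with their index i ∈ ω = ℕ; e_i <₀ e_j iff i < j.
Event : Set
Event = ℕ

_<₀_ : Event → Event → Set
_<₀_ = _<_

-- Add, Rem, Cnt partition the events: every event has exactly one kind.
data Kind : Set where
  add rem cnt : Kind

data Status : Set where
  s0 s1 sf : Status

record SerialSetObject : Set where
  field
    kind : Event → Kind
    val  : Event → ℕ
    χ    : Event → Status
    cnt-status : ∀ a → kind a ≡ cnt → χ a ≢ sf

module _ (S : SerialSetObject) where
  open SerialSetObject S

  Add Rem Cnt : Event → Set
  Add a = kind a ≡ add
  Rem a = kind a ≡ rem
  Cnt a = kind a ≡ cnt

  Add^ Rem^ : Status → Event → Set
  Add^ p a = Add a × χ a ≡ p
  Rem^ p a = Rem a × χ a ≡ p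

  -- Op^p for p ∈ {0,1}: Add, Rem or Cnt (i.e. any event) with status p.
  Op0 Op1 : Event → Set
  Op0 a = χ a ≡ s0
  Op1 a = χ a ≡ s1

  Gamma : Set
  Gamma = (a : Event) → Op1 a → Event

  -- FS0: values of γ are Add⁰ events (the rest of FS0 holds by construction).
  FS0 : Gamma → Set
  FS0 γ = ∀ a (h : Op1 a) → Add^ s0 (γ a h)

  FS1 : Gamma → Set
  FS1 γ = ∀ a (h : Op1 a) →
    (γ a h <₀ a) × Add^ s0 (γ a h) × (val a ≡ val (γ a h)) ×
    (¬ (Σ Event λ r → Σ (Rem^ s1 r) λ hr →
         (γ r (Data.Product.proj₂ hr) ≡ γ a h) × (γ a h <₀ r) × (r <₀ a)))

  FS2 : Gamma → Set
  FS2 γ = ∀ a b → a <₀ b → Add^ s0 a → Op0 b → val a ≡ val b →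
    Σ Event λ r → Σ (Rem^ s1 r) λ hr →
      (a <₀ r) × (r <₀ b) × (a ≡ γ r (Data.Product.proj₂ hr))

module Submission where

open import Defs
open import Data.Nat using (ℕ)
open import Data.Nat.Properties using (<-trans)
open import Data.Product using (_×_; _,_; ∃-syntax; Σ; proj₂)
open import Relation.Binary.PropositionalEquality using (_≡_; sym; trans)
open import Relation.Nullary using (¬_)

-- FS2 yields a Rem¹ event removing γ(x) before y, hence before x, which FS1 forbids.

module _ (S : SerialSetObject) (γ : Gamma S) where
  open SerialSetObject S

  RemovedBetween : Event → Event → Set
  RemovedBetween a z =
    Σ Event λ r → Σ (Rem^ S s1 r) λ hr → (γ r (proj₂ hr) ≡ a) × (a <₀ r) × (r <₀ z)

  no-Op0-before-removal : FS2 S γ → ∀ a z → Add^ S s0 a → ¬ RemovedBetween a z →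
    ¬ (∃[ y ] (Op0 S y × (a <₀ y) × (y <₀ z) × (val a ≡ val y)))
  no-Op0-before-removal fs2 a z add⁰ not-removed (y , op⁰ , a<y , y<z , same-key)
    with fs2 a y a<y add⁰ op⁰ same-key
  ... | r , rem¹ , a<r , r<y , a≡γr = not-removed (r , rem¹ , sym a≡γr , a<r , <-trans r<y y<z)

lemma2p1 : (S : SerialSetObject) → (γ : Gamma S) →
    FS0 S γ → FS1 S γ → FS2 S γ →
    ∀ x (hx : Op1 S x) →
      ¬ (∃[ y ] (Op0 S y × (γ x hx <₀ y) × (y <₀ x) ×
                 (SerialSetObject.val S x ≡ SerialSetObject.val S y)))
lemma2p1 S γ _ fs1 fs2 x hx (y , op⁰ , γx<y , y<x , same-key)
  with fs1 x hx
... | _ , add⁰ , key≡ , not-removed =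
  no-Op0-before-removal S γ fs2 (γ x hx) x add⁰ not-removed
    (y , op⁰ , γx<y , y<x , trans (sym key≡) same-key)
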